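{- If $k\neq (n-1)/2$ (that is, $K(n,k)$ is not an odd graph), then there is no $2$-neighbour-transitive code with minimum distance $\delta\geq 5$ in the Kneser graph $K(n,k)$.
   Context: Let $\Omega$ be a finite set with $|\Omega|=n$ and $2\leq k\leq (n-1)/2$. The Kneser graph $K(n,k)$ has as vertices the $k$-subsets of $\Omega$, adjacent iff disjoint; its automorphism group is $\mathrm{Sym}(\Omega)$. A code $C$ is a set of vertices with $|C|\geq 2$. Writing $d$ for graph distance, the minimum distance $\delta$ is the least distance between distinct codewords. For $i\geq 0$, $C_i$ is the set of vertices $\gamma$ with $\min_{\alpha\in C}d(\alpha,\gamma)=i$; the covering radius $\rho$ is the largest $i$ with $C_i\neq\emptyset$. $\mathrm{Aut}(C)$ is the setwise stabiliser of $C$ in $\mathrm{Sym}(\Omega)$. $C$ is $2$-neighbour-transitive if $\rho\geq 2$ and $\mathrm{Aut}(C)$ is transitive on each of $C$, $C_1$, $C_2$. -}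

module Defs where

open import Data.Nat using (ℕ; zero; suc; _<_; _≤_)
open import Data.Fin using (Fin)
open import Data.Fin.Subset using (Subset; _∈_; _∉_; ∣_∣; _∩_; ⊥)
open import Data.Fin.Permutation using (Permutation′; _⟨$⟩ˡ_)
open import Data.Vec using (tabulate; lookup)
open import Data.Bool using (Bool; true)
open import Data.Product using (Σ; ∃; _×_; _,_)
open import Relation.Nullary using (¬_)
open import Relation.Binary.PropositionalEquality using (_≡_; _≢_)

-- Ω = Fin n.  Vertices of K(n,k): subsets s of Fin n with ∣ s ∣ ≡ k.
IsVertex : {n : ℕ} → ℕ → Subset n → Set
IsVertex k s = ∣ s ∣ ≡ k

-- Adjacency in K(n,k): disjoint (both endpoints are k-subsets).
Disjoint : {n : ℕ} → Subset n → Subset n → Set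
Disjoint s t = s ∩ t ≡ ⊥

data Walk {n : ℕ} (k : ℕ) : Subset n → Subset n → ℕ → Set where
  here : ∀ {s} → Walk k s s zero
  step : ∀ {s t u m} → IsVertex k t → Disjoint s t → Walk k t u m → Walk k s u (suc m)

Dist : {n : ℕ} → ℕ → Subset n → Subset n → ℕ → Set
Dist k α γ i = Walk k α γ i × (∀ j → j < i → ¬ Walk k α γ j)

Code : ℕ → Set
Code n = Subset n → Bool

_∈C_ : {n : ℕ} → Subset n → Code n → Set
α ∈C C = C α ≡ true

IsCode : {n : ℕ} → ℕ → Code n → Set
IsCode k C = (∀ α → α ∈C C → IsVertex k α)
           × Σ _ λ α → Σ _ λ β → α ∈C C × β ∈C C × α ≢ β

MinDistAtLeast : {n : ℕ} → ℕ → Code n → ℕ → Set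
MinDistAtLeast k C m = ∀ α β → α ∈C C → β ∈C C → α ≢ β →
                       ∀ i → Dist k α β i → m ≤ i

InCi : {n : ℕ} → ℕ → Code n → ℕ → Subset n → Set
InCi k C i γ = IsVertex k γ
             × (Σ _ λ α → α ∈C C × Walk k α γ i)
             × (∀ α j → α ∈C C → j < i → ¬ Walk k α γ j)

CovRadiusAtLeast2 : {n : ℕ} → ℕ → Code n → Set
CovRadiusAtLeast2 k C = Σ ℕ λ i → 2 ≤ i × Σ _ λ γ → InCi k C i γ

-- action of a permutation σ of Ω on subsets: σ·s = { σ x | x ∈ s }
act : {n : ℕ} → Permutation′ n → Subset n → Subset n
act σ s = tabulate (λ y → lookup s (σ ⟨$⟩ˡ y))

InAut : {n : ℕ} → Code n → Permutation′ n → Set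
InAut C σ = ∀ α → (α ∈C C → act σ α ∈C C) × (act σ α ∈C C → α ∈C C)

AutTransitiveOn : {n : ℕ} → Code n → (Subset n → Set) → Set
AutTransitiveOn C X = ∀ α β → X α → X β → Σ _ λ σ → InAut C σ × act σ α ≡ β

Is2NeighbourTransitive : {n : ℕ} → ℕ → Code n → Set
Is2NeighbourTransitive k C =
  CovRadiusAtLeast2 k C
  × AutTransitiveOn C (λ α → α ∈C C)
  × AutTransitiveOn C (InCi k C 1)
  × AutTransitiveOn C (InCi k C 2)

-- For k = 2 we have n ≥ 3k, so any two codewords have a common neighbour and δ ≤ 2.
-- Otherwise k ≥ 3 and n ≥ 2k + 2. Fix a codeword α, points a, a′, a″ ∈ α and b, b′ ∉ α, and let
-- β₁ = α − a + b and β₂ = α − a − a′ + b + b′. A k-set x avoiding α ∪ {b, b′} is a common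
-- neighbour of α, β₁ and β₂, and no βᵢ equals α or is disjoint from it (a′ ∈ β₁, a″ ∈ β₂), so
-- δ ≥ 5 puts both in C₂ with α their only codeword within distance 2. An automorphism taking
-- β₁ to β₂ must therefore fix α, which is impossible as |α ∖ β₁| = 1 and |α ∖ β₂| = 2.
module Submission where

open import Defs
open import Data.Nat using (ℕ; _≤_; _+_; _*_)
open import Data.Product using (_×_)
open import Relation.Nullary using (¬_)
open import Relation.Binary.PropositionalEquality using (_≢_)

open import Data.Bool.Base using (Bool; if_then_else_)
open import Data.Fin.Base using (Fin; suc)
open import Data.Fin.Properties using (_≟_)
open import Data.Fin.Permutation using (Permutation′; _⟨$⟩ˡ_; _⟨$⟩ʳ_; flip; transpose; inverseʳ)
import Data.Fin.Permutation.Components as PC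
open import Data.Fin.Subset
  using (Subset; _∈_; _∉_; _⊆_; ⊥; ⁅_⁆; ∁; _∪_; _-_; ∣_∣; Nonempty; inside; outside)
open import Data.Fin.Subset.Properties
  using ( ∣⊥∣≡0; ∣p∣≤∣x∷p∣; ⊆-min; out⊆; s⊆s; p⊆q⇒∣p∣≤∣q∣; nonempty?; Empty-unique; ∉⊥; x∈⁅x⁆; ∣⁅x⁆∣≡1
        ; x∈p∪q⁺; p⊆p∪q; q⊆p∪q; x∈p∩q⁺; x∈p∩q⁻; x∈p∧x≢y⇒x∈p-y; p─q⊆p; x∈∁p⇒x∉p; x∉p⇒x∈∁p; ∣∁p∣≡n∸∣p∣)
open import Data.Nat.Base using (suc; zero; _<_; z≤n; s≤s)
open import Data.Nat.Properties hiding (_≟_)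
open import Data.Nat.Induction using (<-rec)
open import Data.Nat.Tactic.RingSolver using (solve-∀)
open import Algebra.Properties.CommutativeMonoid.Sum +-0-commutativeMonoid using (sum; sum-permute; sum-cong-≗)
open import Data.Product using (∃; _,_; proj₁; proj₂; uncurry)
open import Data.Sum.Base using (_⊎_; inj₁; inj₂; [_,_]′)
open import Data.Vec.Base using ([]; _∷_; lookup; there)
open import Data.Vec.Properties using (lookup∘tabulate; lookup⇒[]=; []=⇒lookup; ≡-dec)
import Data.Bool.Properties as Bool
open import Relation.Nullary using (Dec; yes; no; contradiction)
open import Relation.Nullary.Decidable using (dec-true; dec-false)
open import Relation.Binary.PropositionalEquality using (_≡_; refl; sym; trans; cong; cong₂; subst; module ≡-Reasoning)
open import Function.Base using (_∘_)

private
  variable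
    n : ℕ
    p : Subset n
    y : Fin n

∣p∪q∣≤∣p∣+∣q∣ : ∀ (p q : Subset n) → ∣ p ∪ q ∣ ≤ ∣ p ∣ + ∣ q ∣
∣p∪q∣≤∣p∣+∣q∣ []            []            = z≤n
∣p∪q∣≤∣p∣+∣q∣ (inside  ∷ p) (s ∷ q)       = s≤s (≤-trans (∣p∪q∣≤∣p∣+∣q∣ p q) (+-monoʳ-≤ ∣ p ∣ (∣p∣≤∣x∷p∣ s q)))
∣p∪q∣≤∣p∣+∣q∣ (outside ∷ p) (inside  ∷ q) = ≤-trans (s≤s (∣p∪q∣≤∣p∣+∣q∣ p q)) (≤-reflexive (sym (+-suc ∣ p ∣ ∣ q ∣)))
∣p∪q∣≤∣p∣+∣q∣ (outside ∷ p) (outside ∷ q) = ∣p∪q∣≤∣p∣+∣q∣ p q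

∣p∣≤1+∣p-x∣ : ∀ (p : Subset n) x → ∣ p ∣ ≤ suc ∣ p - x ∣
∣p∣≤1+∣p-x∣ p x = begin
  ∣ p ∣                 ≤⟨ p⊆q⇒∣p∣≤∣q∣ p⊆⁅x⁆∪[p-x] ⟩
  ∣ ⁅ x ⁆ ∪ (p - x) ∣   ≤⟨ ∣p∪q∣≤∣p∣+∣q∣ ⁅ x ⁆ (p - x) ⟩
  ∣ ⁅ x ⁆ ∣ + ∣ p - x ∣ ≡⟨ cong (_+ ∣ p - x ∣) (∣⁅x⁆∣≡1 x) ⟩
  suc ∣ p - x ∣         ∎
  where
  open ≤-Reasoning
  p⊆⁅x⁆∪[p-x] : p ⊆ ⁅ x ⁆ ∪ (p - x)
  p⊆⁅x⁆∪[p-x] {y} y∈p with y ≟ x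
  ... | yes refl = x∈p∪q⁺ (inj₁ (x∈⁅x⁆ x))
  ... | no  y≢x  = x∈p∪q⁺ (inj₂ (x∈p∧x≢y⇒x∈p-y y∈p y≢x))

x∉p-x : ∀ (p : Subset n) x → x ∉ p - x
x∉p-x (_ ∷ p) (suc x) (there x∈p-x) = x∉p-x p x x∈p-x

x∈p-y⁻ : ∀ {p : Subset n} {x} → x ∈ p - y → x ∈ p × x ≢ y
x∈p-y⁻ {y = y} {p} {x} x∈p-y = p─q⊆p p ⁅ y ⁆ x∈p-y , λ { refl → x∉p-x p x x∈p-y }

nonempty : 0 < ∣ p ∣ → Nonempty p
nonempty {n} {p} 0<∣p∣ with nonempty? p
... | yes ne = ne
... | no  ∅  = contradiction (trans (cong ∣_∣ (Empty-unique ∅)) (∣⊥∣≡0 n)) (>⇒≢ 0<∣p∣)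

∃-∈-rest : ∀ {m} → suc m ≤ ∣ p ∣ → ∃ λ x → x ∈ p × m ≤ ∣ p - x ∣
∃-∈-rest {p = p} 1+m≤∣p∣ =
  let x , x∈p = nonempty (≤-trans (s≤s z≤n) 1+m≤∣p∣)
  in x , x∈p , ≤-pred (≤-trans 1+m≤∣p∣ (∣p∣≤1+∣p-x∣ p x))

∃-⊆-size : ∀ {m} → m ≤ ∣ p ∣ → ∃ λ q → q ⊆ p × ∣ q ∣ ≡ m
∃-⊆-size {n} {m = zero} _ = ⊥ , ⊆-min _ , ∣⊥∣≡0 n
∃-⊆-size {p = inside ∷ p} {suc m} (s≤s m≤∣p∣) =
  let q , q⊆p , ∣q∣≡m = ∃-⊆-size m≤∣p∣ in inside ∷ q , s⊆s q⊆p , cong suc ∣q∣≡m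
∃-⊆-size {p = outside ∷ p} {suc m} 1+m≤∣p∣ =
  let q , q⊆p , ∣q∣≡m = ∃-⊆-size 1+m≤∣p∣ in outside ∷ q , out⊆ q⊆p , ∣q∣≡m

Disjoint⁺ : ∀ {s t : Subset n} → (∀ {x} → x ∈ s → x ∉ t) → Disjoint s t
Disjoint⁺ {s = s} {t} no-common = Empty-unique λ (x , x∈s∩t) → uncurry no-common (x∈p∩q⁻ s t x∈s∩t)

Disjoint⁻ : ∀ {s t : Subset n} {x} → Disjoint s t → x ∈ s → x ∉ t
Disjoint⁻ {x = x} s∩t≡⊥ x∈s x∈t = ∉⊥ (subst (x ∈_) s∩t≡⊥ (x∈p∩q⁺ (x∈s , x∈t)))

Disjoint-sym : ∀ {s t : Subset n} → Disjoint s t → Disjoint t s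
Disjoint-sym s∩t≡⊥ = Disjoint⁺ λ x∈t x∈s → Disjoint⁻ s∩t≡⊥ x∈s x∈t

Disjoint-⊆ : ∀ {s t u : Subset n} → s ⊆ t → Disjoint t u → Disjoint s u
Disjoint-⊆ s⊆t t∩u≡⊥ = Disjoint⁺ λ x∈s → Disjoint⁻ t∩u≡⊥ (s⊆t x∈s)

Disjoint⇒⊆∁ : ∀ {s t : Subset n} → Disjoint s t → s ⊆ ∁ t
Disjoint⇒⊆∁ s∩t≡⊥ = x∉p⇒x∈∁p ∘ Disjoint⁻ s∩t≡⊥

⊆∁⇒Disjoint : ∀ {s t : Subset n} → s ⊆ ∁ t → Disjoint s t
⊆∁⇒Disjoint s⊆∁t = Disjoint⁺ (x∈∁p⇒x∉p ∘ s⊆∁t)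

∃-disjoint-vertex : ∀ k (s : Subset n) → k + ∣ s ∣ ≤ n → ∃ λ x → IsVertex k x × Disjoint s x
∃-disjoint-vertex {n} k s k+∣s∣≤n =
  let x , x⊆∁s , ∣x∣≡k = ∃-⊆-size (subst (k ≤_) (sym (∣∁p∣≡n∸∣p∣ s)) (m+n≤o⇒m≤o∸n k k+∣s∣≤n))
  in x , ∣x∣≡k , Disjoint-sym (⊆∁⇒Disjoint x⊆∁s)

∈-act⁻ : ∀ {x} (σ : Permutation′ n) {s} → x ∈ act σ s → σ ⟨$⟩ˡ x ∈ s
∈-act⁻ {x = x} σ {s} x∈σs = lookup⇒[]= _ s (trans (sym (lookup∘tabulate _ x)) ([]=⇒lookup x∈σs))

∈-act⁺ : ∀ {x} (σ : Permutation′ n) {s} → σ ⟨$⟩ˡ x ∈ s → x ∈ act σ s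
∈-act⁺ {x = x} σ {s} σx∈s = lookup⇒[]= x (act σ s) (trans (lookup∘tabulate _ x) ([]=⇒lookup σx∈s))

∣p∣≡∑χ : ∀ (p : Subset n) → ∣ p ∣ ≡ sum (λ i → if lookup p i then 1 else 0)
∣p∣≡∑χ []            = refl
∣p∣≡∑χ (inside  ∷ p) = cong suc (∣p∣≡∑χ p)
∣p∣≡∑χ (outside ∷ p) = ∣p∣≡∑χ p

∣act∣ : ∀ (σ : Permutation′ n) s → ∣ act σ s ∣ ≡ ∣ s ∣
∣act∣ σ s = begin
  ∣ act σ s ∣                  ≡⟨ ∣p∣≡∑χ (act σ s) ⟩
  sum (χ ∘ lookup (act σ s))   ≡⟨ sum-cong-≗ (cong χ ∘ lookup∘tabulate (lookup s ∘ (σ ⟨$⟩ˡ_))) ⟩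
  sum (χ ∘ lookup s ∘ (σ ⟨$⟩ˡ_)) ≡⟨ sum-permute (χ ∘ lookup s) (flip σ) ⟨
  sum (χ ∘ lookup s)           ≡⟨ ∣p∣≡∑χ s ⟨
  ∣ s ∣                        ∎
  where
  open ≡-Reasoning
  χ : Bool → ℕ
  χ b = if b then 1 else 0

act-IsVertex : ∀ {k} (σ : Permutation′ n) {s} → IsVertex k s → IsVertex k (act σ s)
act-IsVertex σ {s} ∣s∣≡k = trans (∣act∣ σ s) ∣s∣≡k

act-Disjoint : ∀ (σ : Permutation′ n) {s t} → Disjoint s t → Disjoint (act σ s) (act σ t)
act-Disjoint σ s∩t≡⊥ = Disjoint⁺ λ x∈σs x∈σt → Disjoint⁻ s∩t≡⊥ (∈-act⁻ σ x∈σs) (∈-act⁻ σ x∈σt)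

module _ {k : ℕ} where

  walk-act : ∀ (σ : Permutation′ n) {s u m} → Walk k s u m → Walk k (act σ s) (act σ u) m
  walk-act σ here                      = here
  walk-act σ (step {t = t} t-vx s∩t w) = step (act-IsVertex σ {t} t-vx) (act-Disjoint σ s∩t) (walk-act σ w)

  walk-++ : ∀ {s t u : Subset n} {l m} → Walk k s t l → Walk k t u m → Walk k s u (l + m)
  walk-++ here              w′ = w′
  walk-++ (step t-vx s∩t w) w′ = step t-vx s∩t (walk-++ w w′)

  walk-via : ∀ {s x u : Subset n} → IsVertex k x → Disjoint s x → IsVertex k u → Disjoint x u → Walk k s u 2
  walk-via x-vx s∩x u-vx x∩u = step x-vx s∩x (step u-vx x∩u here)

  walk<2 : ∀ {s u : Subset n} {j} → Walk k s u j → j < 2 → s ≡ u ⊎ Disjoint s u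
  walk<2 here                    _              = inj₁ refl
  walk<2 (step _ s∩u here)       _              = inj₂ s∩u
  walk<2 (step _ _ (step _ _ _)) (s≤s (s≤s ()))

transpose-i : ∀ (i j : Fin n) → PC.transpose i j i ≡ j
transpose-i i j rewrite dec-true (i ≟ i) refl = refl

transpose-j : ∀ (i j : Fin n) → PC.transpose i j j ≡ i
transpose-j i j with j ≟ i
... | yes j≡i = j≡i
... | no  _   rewrite dec-true (j ≟ j) refl = refl

transpose-fixes : ∀ {i j : Fin n} → y ≢ i → y ≢ j → PC.transpose i j y ≡ y
transpose-fixes {y = y} {i} {j} y≢i y≢j rewrite dec-false (y ≟ i) y≢i | dec-false (y ≟ j) y≢j = refl

∈∧∉⇒≢ : ∀ {s : Subset n} {x} → x ∈ s → y ∉ s → x ≢ y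
∈∧∉⇒≢ x∈s y∉s refl = y∉s x∈s

-- The image of s under the transposition of i and j: s with i replaced by j when i ∈ s and j ∉ s.
exchange : Subset n → Fin n → Fin n → Subset n
exchange s i j = act (transpose j i) s

module _ {s : Subset n} {i j : Fin n} where

  j∈exchange : i ∈ s → j ∈ exchange s i j
  j∈exchange i∈s = ∈-act⁺ (transpose j i) (subst (_∈ s) (sym (transpose-j i j)) i∈s)

  i∉exchange : j ∉ s → i ∉ exchange s i j
  i∉exchange j∉s i∈s′ = j∉s (subst (_∈ s) (transpose-i i j) (∈-act⁻ (transpose j i) i∈s′))

  ∈-exchange⁺ : y ≢ i → y ≢ j → y ∈ s → y ∈ exchange s i j
  ∈-exchange⁺ y≢i y≢j y∈s = ∈-act⁺ (transpose j i) (subst (_∈ s) (sym (transpose-fixes y≢i y≢j)) y∈s)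

  ∈-exchange⁻ : y ≢ i → y ≢ j → y ∈ exchange s i j → y ∈ s
  ∈-exchange⁻ y≢i y≢j y∈s′ = subst (_∈ s) (transpose-fixes y≢i y≢j) (∈-act⁻ (transpose j i) y∈s′)

  exchange-⊆ : ∀ {t} → i ∈ t → j ∈ t → s ⊆ t → exchange s i j ⊆ t
  exchange-⊆ i∈t j∈t s⊆t {y} y∈s′ with y ≟ i | y ≟ j
  ... | yes refl | _        = i∈t
  ... | no  _    | yes refl = j∈t
  ... | no  y≢i  | no  y≢j  = s⊆t (∈-exchange⁻ y≢i y≢j y∈s′)

  ∈∧∉exchange⇒≡ : j ∉ s → y ∈ s → y ∉ exchange s i j → y ≡ i
  ∈∧∉exchange⇒≡ {y} j∉s y∈s y∉s′ with y ≟ i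
  ... | yes y≡i = y≡i
  ... | no  y≢i = contradiction (∈-exchange⁺ y≢i (∈∧∉⇒≢ y∈s j∉s) y∈s) y∉s′

record TwoExchanges (k : ℕ) (α : Subset n) : Set where
  field
    a a′ a″ b b′ : Fin n
    a∈α   : a ∈ α
    a′∈α  : a′ ∈ α
    a″∈α  : a″ ∈ α
    a′≢a  : a′ ≢ a
    a″≢a  : a″ ≢ a
    a″≢a′ : a″ ≢ a′
    b∉α   : b ∉ α
    b′∉α  : b′ ∉ α
    b′≢b  : b′ ≢ b
    x        : Subset n
    x-vertex : IsVertex k x
    α∩x      : Disjoint α x
    b∉x      : b ∉ x
    b′∉x     : b′ ∉ x

  β₁ : Subset n
  β₁ = exchange α a b

  β₂ : Subset n
  β₂ = exchange β₁ a′ b′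

  private
    b∈β₁ : b ∈ β₁
    b∈β₁ = j∈exchange a∈α
    a′∈β₁ : a′ ∈ β₁
    a′∈β₁ = ∈-exchange⁺ a′≢a (∈∧∉⇒≢ a′∈α b∉α) a′∈α
    a″∈β₁ : a″ ∈ β₁
    a″∈β₁ = ∈-exchange⁺ a″≢a (∈∧∉⇒≢ a″∈α b∉α) a″∈α
    a∉β₁ : a ∉ β₁
    a∉β₁ = i∉exchange b∉α
    b′∉β₁ : b′ ∉ β₁
    b′∉β₁ = b′∉α ∘ ∈-exchange⁻ (∈∧∉⇒≢ a∈α b′∉α ∘ sym) b′≢b
    b∈β₂ : b ∈ β₂
    b∈β₂ = ∈-exchange⁺ (∈∧∉⇒≢ a′∈α b∉α ∘ sym) (b′≢b ∘ sym) b∈β₁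
    a″∈β₂ : a″ ∈ β₂
    a″∈β₂ = ∈-exchange⁺ a″≢a′ (∈∧∉⇒≢ a″∈β₁ b′∉β₁) a″∈β₁
    a∉β₂ : a ∉ β₂
    a∉β₂ = a∉β₁ ∘ ∈-exchange⁻ (a′≢a ∘ sym) (∈∧∉⇒≢ a∈α b′∉α)
    a′∉β₂ : a′ ∉ β₂
    a′∉β₂ = i∉exchange b′∉β₁
    α⊆∁x : α ⊆ ∁ x
    α⊆∁x = Disjoint⇒⊆∁ α∩x
    β₁⊆∁x : β₁ ⊆ ∁ x
    β₁⊆∁x = exchange-⊆ (α⊆∁x a∈α) (x∉p⇒x∈∁p b∉x) α⊆∁x
    β₂⊆∁x : β₂ ⊆ ∁ x
    β₂⊆∁x = exchange-⊆ (α⊆∁x a′∈α) (x∉p⇒x∈∁p b′∉x) β₁⊆∁x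

  β₁-vertex : IsVertex k α → IsVertex k β₁
  β₁-vertex = act-IsVertex (transpose b a) {α}

  β₂-vertex : IsVertex k α → IsVertex k β₂
  β₂-vertex = act-IsVertex (transpose b′ a′) {β₁} ∘ β₁-vertex

  x∩β₁ : Disjoint x β₁
  x∩β₁ = Disjoint-sym (⊆∁⇒Disjoint β₁⊆∁x)

  x∩β₂ : Disjoint x β₂
  x∩β₂ = Disjoint-sym (⊆∁⇒Disjoint β₂⊆∁x)

  α≢β₁ : α ≢ β₁
  α≢β₁ α≡β₁ = b∉α (subst (b ∈_) (sym α≡β₁) b∈β₁)

  α≢β₂ : α ≢ β₂
  α≢β₂ α≡β₂ = b∉α (subst (b ∈_) (sym α≡β₂) b∈β₂)

  α≬β₁ : ¬ Disjoint α β₁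
  α≬β₁ α∩β₁ = Disjoint⁻ α∩β₁ a′∈α a′∈β₁

  α≬β₂ : ¬ Disjoint α β₂
  α≬β₂ α∩β₂ = Disjoint⁻ α∩β₂ a″∈α a″∈β₂

  -- σ⁻¹ would map both a and a′, the points of α outside β₂, to a, the only point of α outside β₁.
  stabiliser-cannot-map-β₁-to-β₂ : ∀ (σ : Permutation′ n) → act σ α ≡ α → act σ β₁ ≢ β₂
  stabiliser-cannot-map-β₁-to-β₂ σ σα≡α σβ₁≡β₂ = a′≢a (begin
    a′                     ≡⟨ inverseʳ σ ⟨
    σ ⟨$⟩ʳ (σ ⟨$⟩ˡ a′)    ≡⟨ cong (σ ⟨$⟩ʳ_) (trans (σ⁻¹-sends-to-a a′∈α a′∉β₂) (sym (σ⁻¹-sends-to-a a∈α a∉β₂))) ⟩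
    σ ⟨$⟩ʳ (σ ⟨$⟩ˡ a)     ≡⟨ inverseʳ σ ⟩
    a                      ∎)
    where
    open ≡-Reasoning
    σ⁻¹-sends-to-a : ∀ {y} → y ∈ α → y ∉ β₂ → σ ⟨$⟩ˡ y ≡ a
    σ⁻¹-sends-to-a {y} y∈α y∉β₂ = ∈∧∉exchange⇒≡ b∉α
      (∈-act⁻ σ (subst (y ∈_) (sym σα≡α) y∈α))
      (λ σ⁻¹y∈β₁ → y∉β₂ (subst (y ∈_) σβ₁≡β₂ (∈-act⁺ σ σ⁻¹y∈β₁)))

twoExchanges : ∀ {k} {α : Subset n} → 3 ≤ k → 2 * k + 2 ≤ n → IsVertex k α → TwoExchanges k α
twoExchanges {n} {k} {α} 3≤k 2k+2≤n ∣α∣≡k =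
  let a  , a∈α       , 2≤∣α-a∣    = ∃-∈-rest (subst (3 ≤_) (sym ∣α∣≡k) 3≤k)
      a′ , a′∈α-a    , 1≤∣α-a-a′∣ = ∃-∈-rest 2≤∣α-a∣
      a″ , a″∈α-a-a′ , _          = ∃-∈-rest 1≤∣α-a-a′∣
      y  , ∣y∣≡2+k   , α∩y        = ∃-disjoint-vertex (2 + k) α 2+k+∣α∣≤n
      b  , b∈y       , 1+k≤∣y-b∣  = ∃-∈-rest (≤-reflexive (sym ∣y∣≡2+k))
      b′ , b′∈y-b    , k≤∣y-b-b′∣ = ∃-∈-rest 1+k≤∣y-b∣
      x  , x⊆y-b-b′  , ∣x∣≡k      = ∃-⊆-size k≤∣y-b-b′∣
      a′∈α   , a′≢a  = x∈p-y⁻ a′∈α-a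
      a″∈α-a , a″≢a′ = x∈p-y⁻ a″∈α-a-a′
      a″∈α   , a″≢a  = x∈p-y⁻ a″∈α-a
      b′∈y   , b′≢b  = x∈p-y⁻ b′∈y-b
      y∩α = Disjoint-sym α∩y
      x⊆y-b : x ⊆ y - b
      x⊆y-b = p─q⊆p (y - b) ⁅ b′ ⁆ ∘ x⊆y-b-b′
  in record
    { a = a ; a′ = a′ ; a″ = a″ ; b = b ; b′ = b′ ; x = x
    ; a∈α = a∈α ; a′∈α = a′∈α ; a″∈α = a″∈α ; a′≢a = a′≢a ; a″≢a = a″≢a ; a″≢a′ = a″≢a′
    ; b∉α = Disjoint⁻ y∩α b∈y ; b′∉α = Disjoint⁻ y∩α b′∈y ; b′≢b = b′≢b
    ; x-vertex = ∣x∣≡k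
    ; α∩x  = Disjoint⁺ λ z∈α z∈x → Disjoint⁻ α∩y z∈α (p─q⊆p y ⁅ b ⁆ (x⊆y-b z∈x))
    ; b∉x  = x∉p-x y b ∘ x⊆y-b
    ; b′∉x = x∉p-x (y - b) b′ ∘ x⊆y-b-b′
    }
  where
  2+k+∣α∣≤n : 2 + k + ∣ α ∣ ≤ n
  2+k+∣α∣≤n = subst (_≤ n) (trans (2k+2≡2+k+k k) (cong (2 + k +_) (sym ∣α∣≡k))) 2k+2≤n
    where
    2k+2≡2+k+k : ∀ k → 2 * k + 2 ≡ 2 + k + k
    2k+2≡2+k+k = solve-∀

_≟ₛ_ : (s t : Subset n) → Dec (s ≡ t)
_≟ₛ_ = ≡-dec Bool._≟_

module _ {k : ℕ} {C : Code n} where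

  short-walk-free : ∀ {m α β} → MinDistAtLeast k C m → α ∈C C → β ∈C C → α ≢ β →
                    ∀ j → j < m → ¬ Walk k α β j
  short-walk-free {m} {α} {β} δ≥m α∈C β∈C α≢β =
    <-rec (λ j → j < m → ¬ Walk k α β j) λ j shorter j<m w →
      <⇒≱ j<m (δ≥m α β α∈C β∈C α≢β j (w , λ i i<j → shorter i<j (<-trans i<j j<m)))

  min-distance≤2 : ∀ {m} → 3 * k ≤ n → IsCode k C → MinDistAtLeast k C m → m ≤ 2
  min-distance≤2 {m} 3k≤n (vertex , α , α′ , α∈C , α′∈C , α≢α′) δ≥m =
    let x , x-vx , α∪α′∩x = ∃-disjoint-vertex k (α ∪ α′) k+∣α∪α′∣≤n
        α∩x  = Disjoint-⊆ (p⊆p∪q α′) α∪α′∩x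
        α′∩x = Disjoint-⊆ (q⊆p∪q α α′) α∪α′∩x
    in ≮⇒≥ λ 2<m → short-walk-free δ≥m α∈C α′∈C α≢α′ 2 2<m
                     (walk-via x-vx α∩x (vertex α′ α′∈C) (Disjoint-sym α′∩x))
    where
    open ≤-Reasoning
    k+∣α∪α′∣≤n : k + ∣ α ∪ α′ ∣ ≤ n
    k+∣α∪α′∣≤n = begin
      k + ∣ α ∪ α′ ∣       ≤⟨ +-monoʳ-≤ k (∣p∪q∣≤∣p∣+∣q∣ α α′) ⟩
      k + (∣ α ∣ + ∣ α′ ∣) ≡⟨ cong₂ (λ i j → k + (i + j)) (vertex α α∈C) (vertex α′ α′∈C) ⟩
      k + (k + k)          ≡⟨ cong (λ i → k + (k + i)) (+-identityʳ k) ⟨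
      3 * k                ≤⟨ 3k≤n ⟩
      n                    ∎

  module _ (isCode : IsCode k C) (δ≥5 : MinDistAtLeast k C 5) where

    ∈C₂-via : ∀ {α x β} → α ∈C C → IsVertex k x → Disjoint α x → IsVertex k β → Disjoint x β →
              α ≢ β → ¬ Disjoint α β → InCi k C 2 β
    ∈C₂-via {α} {x} {β} α∈C x-vx α∩x β-vx x∩β α≢β α≬β =
      β-vx , (α , α∈C , walk-via x-vx α∩x β-vx x∩β) , no-closer-codeword
      where
      β→α : Walk k β α 2
      β→α = walk-via x-vx (Disjoint-sym x∩β) (proj₁ isCode α α∈C) (Disjoint-sym α∩x)
      no-closer-codeword : ∀ γ j → γ ∈C C → j < 2 → ¬ Walk k γ β j
      no-closer-codeword γ j γ∈C j<2 γ→β with γ ≟ₛ α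
      ... | yes refl = [ α≢β , α≬β ]′ (walk<2 γ→β j<2)
      ... | no  γ≢α  = short-walk-free δ≥5 γ∈C α∈C γ≢α (j + 2) (m<n⇒m<1+n (+-monoˡ-< 2 j<2)) (walk-++ γ→β β→α)

    Aut-fixes-codeword : ∀ {σ α β} → InAut C σ → α ∈C C → Walk k α β 2 → Walk k (act σ β) α 2 → act σ α ≡ α
    Aut-fixes-codeword {σ} {α} σ∈Aut α∈C α→β σβ→α with act σ α ≟ₛ α
    ... | yes σα≡α = σα≡α
    ... | no  σα≢α = contradiction (walk-++ (walk-act σ α→β) σβ→α)
                       (short-walk-free δ≥5 (proj₁ (σ∈Aut α) α∈C) α∈C σα≢α 4 ≤-refl)

    ¬AutTransitiveOn-C₂ : 3 ≤ k → 2 * k + 2 ≤ n → ¬ AutTransitiveOn C (InCi k C 2)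
    ¬AutTransitiveOn-C₂ 3≤k 2k+2≤n C₂-transitive =
      let σ , σ∈Aut , σβ₁≡β₂ = C₂-transitive β₁ β₂ β₁∈C₂ β₂∈C₂
          σα≡α = Aut-fixes-codeword {σ} {α} {β₁} σ∈Aut α∈C α→β₁ (subst (λ β → Walk k β α 2) (sym σβ₁≡β₂) β₂→α)
      in stabiliser-cannot-map-β₁-to-β₂ σ σα≡α σβ₁≡β₂
      where
      α : Subset n
      α = proj₁ (proj₂ isCode)
      α∈C : α ∈C C
      α∈C = proj₁ (proj₂ (proj₂ (proj₂ isCode)))
      α-vertex : IsVertex k α
      α-vertex = proj₁ isCode α α∈C
      open TwoExchanges (twoExchanges {α = α} 3≤k 2k+2≤n α-vertex)
      β₁∈C₂ : InCi k C 2 β₁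
      β₁∈C₂ = ∈C₂-via α∈C x-vertex α∩x (β₁-vertex α-vertex) x∩β₁ α≢β₁ α≬β₁
      β₂∈C₂ : InCi k C 2 β₂
      β₂∈C₂ = ∈C₂-via α∈C x-vertex α∩x (β₂-vertex α-vertex) x∩β₂ α≢β₂ α≬β₂
      α→β₁ : Walk k α β₁ 2
      α→β₁ = walk-via x-vertex α∩x (β₁-vertex α-vertex) x∩β₁
      β₂→α : Walk k β₂ α 2
      β₂→α = walk-via x-vertex (Disjoint-sym x∩β₂) α-vertex (Disjoint-sym α∩x)

theorem3p1 : (n k : ℕ) → 2 ≤ k → 2 * k + 1 ≤ n → n ≢ 2 * k + 1 →
    (C : Code n) → IsCode k C →
    ¬ (Is2NeighbourTransitive k C × MinDistAtLeast k C 5)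
theorem3p1 n k 2≤k 2k+1≤n n≢2k+1 C isCode ((_ , _ , _ , C₂-transitive) , δ≥5) =
  [ (λ 3≤k → ¬AutTransitiveOn-C₂ isCode δ≥5 3≤k 2k+2≤n C₂-transitive)
  , (λ { refl → <⇒≱ (s≤s (s≤s (s≤s z≤n))) (min-distance≤2 2k+2≤n isCode δ≥5) })
  ]′ (m≤n⇒m<n∨m≡n 2≤k)
  where
  2k+2≤n : 2 * k + 2 ≤ n
  2k+2≤n = subst (_≤ n) (sym (+-suc (2 * k) 1)) (≤∧≢⇒< 2k+1≤n (n≢2k+1 ∘ sym))
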